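{- Let $(X,Q)$ be a continuous-time Markov chain with finite state set $X$ and transition rate matrix $Q\in\mathbb{R}^{X\times X}$, and for $\tau>0$ let $D_\tau=(X,F_\tau)$ be the discrete-time dynamical system with $F_\tau(s)=s+\tau Q^T s$. Then for all sufficiently small $\tau>0$, $D_\tau$ describes an (embedded) discrete-time Markov chain of $(X,Q)$, i.e., $I+\tau Q$ is a stochastic matrix. Moreover, for a partition $\mathcal{X}_R$ of $X$ and the monoid $(\mathbb{R},+)$, the following are equivalent: (1) $\mathcal{X}_R$ is a generalized forward bisimulation (GFB) of $D_\tau$ for all $\tau>0$; (2) $\mathcal{X}_R$ is an ordinary lumpability of $(X,Q)$; (3) $\mathcal{X}_R$ is a probabilistic bisimulation of every $D_\tau$ that describes a discrete-time Markov chain (i.e., of the chain with transition matrix $I+\tau Q$ for every $\tau>0$ for which this matrix is stochastic).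
   Context: A transition rate matrix $Q$ has nonnegative off-diagonal entries and rows summing to zero. The update function of $x\in X$ in $D_\tau$ is $f_x(s)=s_x+\tau (Q^Ts)_x$. A partition $\mathcal{P}$ of $X$ is a GFB (for $(\mathbb{R},+)$) of $D_\tau$ if for all $s,s'\in\mathbb{R}^X$: whenever $\sum_{x\in C}s_x=\sum_{x\in C}s'_x$ for all blocks $C\in\mathcal{P}$, then $\sum_{x\in C}f_x(s)=\sum_{x\in C}f_x(s')$ for all blocks $C$. A partition $\mathcal{P}$ is an ordinary lumpability of $(X,Q)$ if for all blocks $C,C'\in\mathcal{P}$ and all $x,y\in C$, $\sum_{z\in C'}Q_{x,z}=\sum_{z\in C'}Q_{y,z}$. For a discrete-time Markov chain with stochastic transition matrix $P$ on $X$, $\mathcal{P}$ is a probabilistic bisimulation if for all blocks $C,C'\in\mathcal{P}$ and all $x,y\in C$, $\sum_{z\in C'}P_{x,z}=\sum_{z\in C'}P_{y,z}$. -}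

module Defs where

open import Level using (Level; _⊔_) renaming (suc to lsuc)
open import Algebra.Bundles using (CommutativeRing)
open import Relation.Binary.Structures using (IsTotalOrder)
open import Relation.Nullary using (¬_; does)
open import Relation.Binary.PropositionalEquality using (_≡_)
open import Data.Nat using (ℕ; zero; suc)
open import Data.Fin using (Fin; zero; suc; _≟_)
open import Data.Bool using (if_then_else_)
open import Data.Product using (Σ; _×_)

-- An ordered field (the statement is made for an arbitrary ordered field,
-- in particular for the real numbers ℝ, which agda-stdlib lacks).
record OrderedField (c ℓ₁ ℓ₂ : Level) : Set (lsuc (c ⊔ ℓ₁ ⊔ ℓ₂)) where
  field
    commutativeRing : CommutativeRing c ℓ₁
  open CommutativeRing commutativeRing public
  field
    _≤_          : Carrier → Carrier → Set ℓ₂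
    isTotalOrder : IsTotalOrder _≈_ _≤_
    +-mono-≤     : ∀ {a b} c → a ≤ b → (a + c) ≤ (b + c)
    *-nonneg     : ∀ {a b} → 0# ≤ a → 0# ≤ b → 0# ≤ (a * b)
    0≉1          : ¬ (0# ≈ 1#)
    inverse      : ∀ x → ¬ (x ≈ 0#) → Σ Carrier (λ y → (x * y) ≈ 1#)

  _<_ : Carrier → Carrier → Set (ℓ₁ ⊔ ℓ₂)
  x < y = (x ≤ y) × ¬ (x ≈ y)

module _ {c ℓ₁ ℓ₂ : Level} (K : OrderedField c ℓ₁ ℓ₂) where
  open OrderedField K using (Carrier; _≈_; _+_; _*_; 0#; 1#; _≤_)

  ∑ : (n : ℕ) → (Fin n → Carrier) → Carrier
  ∑ zero    f = 0#
  ∑ (suc n) f = f zero + ∑ n (λ i → f (suc i))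

  Vector : ℕ → Set c
  Vector n = Fin n → Carrier

  Matrix : ℕ → Set c
  Matrix n = Fin n → Fin n → Carrier

  IsRateMatrix : (n : ℕ) → Matrix n → Set (ℓ₁ ⊔ ℓ₂)
  IsRateMatrix n Q =
    (∀ x y → ¬ (x ≡ y) → 0# ≤ Q x y) × (∀ x → ∑ n (Q x) ≈ 0#)

  IsStochastic : (n : ℕ) → Matrix n → Set (ℓ₁ ⊔ ℓ₂)
  IsStochastic n P = (∀ x y → 0# ≤ P x y) × (∀ x → ∑ n (P x) ≈ 1#)

  I+τQ : (n : ℕ) → Carrier → Matrix n → Matrix n
  I+τQ n τ Q x y = (if does (x ≟ y) then 1# else 0#) + τ * Q x y

  F : (n : ℕ) → Carrier → Matrix n → Vector n → Vector n
  F n τ Q s x = s x + τ * ∑ n (λ y → Q y x * s y)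

  -- A partition of X = Fin n is given by a block labelling b : Fin n → Fin m;
  -- the blocks are the (nonempty) fibres of b.
  -- sum of s over the block with label C
  blockSum : (n m : ℕ) → (Fin n → Fin m) → Vector n → Fin m → Carrier
  blockSum n m b s C = ∑ n (λ x → if does (b x ≟ C) then s x else 0#)

  IsGFB : (n m : ℕ) → (Vector n → Vector n) → (Fin n → Fin m) → Set (c ⊔ ℓ₁)
  IsGFB n m G b = ∀ (s s′ : Vector n) →
    (∀ C → blockSum n m b s C ≈ blockSum n m b s′ C) →
    ∀ C → blockSum n m b (G s) C ≈ blockSum n m b (G s′) C

  IsOrdinaryLumpability : (n m : ℕ) → Matrix n → (Fin n → Fin m) → Set ℓ₁
  IsOrdinaryLumpability n m Q b = ∀ (C′ : Fin m) (x y : Fin n) → b x ≡ b y →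
    blockSum n m b (Q x) C′ ≈ blockSum n m b (Q y) C′

  IsProbabilisticBisimulation : (n m : ℕ) → Matrix n → (Fin n → Fin m) → Set ℓ₁
  IsProbabilisticBisimulation n m P b = ∀ (C′ : Fin m) (x y : Fin n) → b x ≡ b y →
    blockSum n m b (P x) C′ ≈ blockSum n m b (P y) C′

{-# OPTIONS --safe #-}

-- The block sums of F_τ(s) are those of s plus τ · Σ_y s_y · (row y of Q summed over the block), and
-- row x of I + τQ is F_τ applied to the unit vector δ_x.  Under lumpability the weight of s_y depends
-- only on the block of y, so F_τ maps states with equal block sums to states with equal block sums.
-- Conversely, comparing δ_x with δ_y for x, y in one block, in a GFB or in the rows of a probabilistic
-- bisimulation, and cancelling τ ≠ 0 recovers lumpability, so a single τ suffices.  Finally, the diagonal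
-- of a rate matrix is nonpositive and its rows sum to zero, so I + τQ is stochastic once
-- τ ≤ 1 / (1 + Σ_x |Q_xx|).
module Submission where

open import Defs
open import Level using (Level)
open import Data.Nat using (ℕ; zero; suc)
open import Data.Fin using (Fin; zero; suc; _≟_)
open import Data.Fin.Properties using (any?; suc-injective)
open import Data.Bool using (Bool; true; false; if_then_else_)
open import Data.Product using (Σ; _×_; _,_; proj₁; proj₂; ∃)
open import Data.Sum using (inj₁; inj₂)
open import Data.Empty using (⊥-elim)
open import Function.Base using (_∘_)
open import Function.Bundles using (_⇔_; mk⇔; Equivalence)
open import Relation.Nullary using (¬_; does; yes; no; Dec)
open import Relation.Nullary.Decidable using (dec-true; dec-false)
open import Relation.Binary.Bundles using (Poset)
open import Relation.Binary.Structures using (IsTotalOrder)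
open import Relation.Binary.PropositionalEquality as ≡ using (_≡_; _≢_)
import Algebra.Properties.Ring as RingProperties
import Algebra.Properties.CommutativeSemigroup as CommutativeSemigroupProperties
import Relation.Binary.Reasoning.Setoid as SetoidReasoning
import Relation.Binary.Reasoning.PartialOrder as PartialOrderReasoning

module OrderedFieldProperties {c ℓ₁ ℓ₂ : Level} (K : OrderedField c ℓ₁ ℓ₂) where
  open OrderedField K hiding (zero)
  open RingProperties ring
    using (-‿distribˡ-*; -‿distribʳ-*; -‿involutive; +-inverseʳ-unique; +-cancelˡ; [y-z]x≈yx-zx)
  open CommutativeSemigroupProperties +-commutativeSemigroup
    using (interchange; x∙yz≈y∙xz)
  open IsTotalOrder isTotalOrder using (total; antisym; ≤-respʳ-≈)
    renaming (refl to ≤-refl; trans to ≤-trans)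

  poset : Poset c ℓ₁ ℓ₂
  poset = record { isPartialOrder = IsTotalOrder.isPartialOrder isTotalOrder }

  δ : ∀ {k} → Fin k → Fin k → Carrier
  δ i j = if does (i ≟ j) then 1# else 0#

  δ-diagonal : ∀ {k} (i : Fin k) → δ i i ≡ 1#
  δ-diagonal i = ≡.cong (if_then 1# else 0#) (dec-true (i ≟ i) ≡.refl)

  δ-offDiagonal : ∀ {k} {i j : Fin k} → i ≢ j → δ i j ≡ 0#
  δ-offDiagonal {i = i} {j} i≢j = ≡.cong (if_then 1# else 0#) (dec-false (i ≟ j) i≢j)

  if-then-0-else-0 : ∀ (d : Bool) → (if d then 0# else 0#) ≈ 0#
  if-then-0-else-0 true  = refl
  if-then-0-else-0 false = refl

  -- ∑ K satisfies the same recursion as the library's sum but is not definitionally equal to it.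
  module _ where
    open SetoidReasoning setoid

    ∑-cong : ∀ k {f g : Fin k → Carrier} → (∀ i → f i ≈ g i) → ∑ K k f ≈ ∑ K k g
    ∑-cong zero    f≈g = refl
    ∑-cong (suc k) f≈g = +-cong (f≈g zero) (∑-cong k (f≈g ∘ suc))

    ∑-zero : ∀ k {f : Fin k → Carrier} → (∀ i → f i ≈ 0#) → ∑ K k f ≈ 0#
    ∑-zero zero    f≈0 = refl
    ∑-zero (suc k) f≈0 = trans (+-cong (f≈0 zero) (∑-zero k (f≈0 ∘ suc))) (+-identityˡ 0#)

    ∑-distrib-+ : ∀ k (f g : Fin k → Carrier) → ∑ K k (λ i → f i + g i) ≈ ∑ K k f + ∑ K k g
    ∑-distrib-+ zero    f g = sym (+-identityˡ 0#)
    ∑-distrib-+ (suc k) f g = trans (+-congˡ (∑-distrib-+ k (f ∘ suc) (g ∘ suc))) (interchange _ _ _ _)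

    *-distribˡ-∑ : ∀ k a (f : Fin k → Carrier) → a * ∑ K k f ≈ ∑ K k (λ i → a * f i)
    *-distribˡ-∑ zero    a f = zeroʳ a
    *-distribˡ-∑ (suc k) a f = trans (distribˡ a _ _) (+-congˡ (*-distribˡ-∑ k a (f ∘ suc)))

    *-distribʳ-∑ : ∀ k a (f : Fin k → Carrier) → ∑ K k f * a ≈ ∑ K k (λ i → f i * a)
    *-distribʳ-∑ zero    a f = zeroˡ a
    *-distribʳ-∑ (suc k) a f = trans (distribʳ a _ _) (+-congˡ (*-distribʳ-∑ k a (f ∘ suc)))

    ∑-comm : ∀ k l (f : Fin k → Fin l → Carrier) →
      ∑ K k (λ i → ∑ K l (f i)) ≈ ∑ K l (λ j → ∑ K k (λ i → f i j))
    ∑-comm zero    l f = sym (∑-zero l (λ _ → refl))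
    ∑-comm (suc k) l f =
      trans (+-congˡ (∑-comm k l (f ∘ suc))) (sym (∑-distrib-+ l (f zero) _))

    ∑-linear : ∀ k τ (u v : Fin k → Carrier) →
      ∑ K k (λ i → u i + τ * v i) ≈ ∑ K k u + τ * ∑ K k v
    ∑-linear k τ u v = trans (∑-distrib-+ k u _) (+-congˡ (sym (*-distribˡ-∑ k τ v)))

    ∑-single : ∀ k (i : Fin k) (f : Fin k → Carrier) → (∀ j → j ≢ i → f j ≈ 0#) → ∑ K k f ≈ f i
    ∑-single (suc k) zero    f f≈0 =
      trans (+-congˡ (∑-zero k (λ j → f≈0 (suc j) λ ()))) (+-identityʳ _)
    ∑-single (suc k) (suc i) f f≈0 =
      trans (+-cong (f≈0 zero λ ()) (∑-single k i (f ∘ suc) λ j j≢i → f≈0 (suc j) (j≢i ∘ suc-injective)))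
            (+-identityˡ _)

    ∑-select : ∀ k (i : Fin k) (f : Fin k → Carrier) →
      ∑ K k (λ j → if does (i ≟ j) then f j else 0#) ≈ f i
    ∑-select k i f =
      trans (∑-single k i _ off) (reflexive (≡.cong (if_then f i else 0#) (dec-true (i ≟ i) ≡.refl)))
      where
      off : ∀ j → j ≢ i → (if does (i ≟ j) then f j else 0#) ≈ 0#
      off j j≢i = reflexive (≡.cong (if_then f j else 0#) (dec-false (i ≟ j) (j≢i ∘ ≡.sym)))

    ∑-split : ∀ k (i : Fin k) (f : Fin k → Carrier) →
      ∑ K k f ≈ f i + ∑ K k (λ j → if does (i ≟ j) then 0# else f j)
    ∑-split (suc k) zero    f = +-congˡ (sym (+-identityˡ _))
    ∑-split (suc k) (suc i) f = begin
      f zero + ∑ K k (f ∘ suc)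
        ≈⟨ +-congˡ (∑-split k i (f ∘ suc)) ⟩
      f zero + (f (suc i) + ∑ K k (λ j → if does (i ≟ j) then 0# else f (suc j)))
        ≈⟨ x∙yz≈y∙xz _ _ _ ⟩
      f (suc i) + (f zero + ∑ K k (λ j → if does (i ≟ j) then 0# else f (suc j))) ∎

    *-cancelˡ-≉0 : ∀ {a} → ¬ (a ≈ 0#) → ∀ {x y} → a * x ≈ a * y → x ≈ y
    *-cancelˡ-≉0 {a} a≉0 {x} {y} ax≈ay = begin
      x               ≈⟨ *-identityˡ x ⟨
      1# * x          ≈⟨ *-congʳ a⁻¹a≈1 ⟨
      a⁻¹ * a * x     ≈⟨ *-assoc a⁻¹ a x ⟩
      a⁻¹ * (a * x)   ≈⟨ *-congˡ ax≈ay ⟩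
      a⁻¹ * (a * y)   ≈⟨ *-assoc a⁻¹ a y ⟨
      a⁻¹ * a * y     ≈⟨ *-congʳ a⁻¹a≈1 ⟩
      1# * y          ≈⟨ *-identityˡ y ⟩
      y               ∎
      where
      a⁻¹ : Carrier
      a⁻¹ = proj₁ (inverse a a≉0)
      a⁻¹a≈1 : a⁻¹ * a ≈ 1#
      a⁻¹a≈1 = trans (*-comm a⁻¹ a) (proj₂ (inverse a a≉0))

    if-distribʳ-* : ∀ (d : Bool) a s → (if d then a * s else 0#) ≈ (if d then a else 0#) * s
    if-distribʳ-* true  a s = refl
    if-distribʳ-* false a s = sym (zeroˡ s)

    if-distrib-∑ : ∀ (d : Bool) k (f : Fin k → Carrier) →
      (if d then ∑ K k f else 0#) ≈ ∑ K k (λ i → if d then f i else 0#)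
    if-distrib-∑ true  k f = refl
    if-distrib-∑ false k f = sym (∑-zero k (λ _ → refl))

    if-distrib-linear : ∀ (d : Bool) τ a a′ →
      (if d then a + τ * a′ else 0#) ≈ (if d then a else 0#) + τ * (if d then a′ else 0#)
    if-distrib-linear true  τ a a′ = refl
    if-distrib-linear false τ a a′ = sym (trans (+-congˡ (zeroʳ τ)) (+-identityˡ 0#))

    if-cong : ∀ (d : Bool) {a a′} → a ≈ a′ → (if d then a else 0#) ≈ (if d then a′ else 0#)
    if-cong true  a≈a′ = a≈a′
    if-cong false a≈a′ = refl

  module _ where
    open PartialOrderReasoning poset

    0≤y-x⇒x≤y : ∀ {x y} → 0# ≤ (y - x) → x ≤ y
    0≤y-x⇒x≤y {x} {y} 0≤y-x = begin
      x            ≈⟨ +-identityˡ x ⟨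
      0# + x       ≤⟨ +-mono-≤ x 0≤y-x ⟩
      y - x + x    ≈⟨ +-assoc y (- x) x ⟩
      y + (- x + x) ≈⟨ +-congˡ (-‿inverseˡ x) ⟩
      y + 0#       ≈⟨ +-identityʳ y ⟩
      y            ∎

    x≤y⇒0≤y-x : ∀ {x y} → x ≤ y → 0# ≤ (y - x)
    x≤y⇒0≤y-x {x} {y} x≤y = begin
      0#     ≈⟨ -‿inverseʳ x ⟨
      x - x  ≤⟨ +-mono-≤ (- x) x≤y ⟩
      y - x  ∎

    x≤0⇒0≤-x : ∀ {x} → x ≤ 0# → 0# ≤ (- x)
    x≤0⇒0≤-x {x} x≤0 = ≤-respʳ-≈ (+-identityˡ (- x)) (x≤y⇒0≤y-x x≤0)

    x≤x+y : ∀ x {y} → 0# ≤ y → x ≤ (x + y)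
    x≤x+y x {y} 0≤y = 0≤y-x⇒x≤y (≤-respʳ-≈ (sym (x+y-x≈y)) 0≤y)
      where
      x+y-x≈y : x + y - x ≈ y
      x+y-x≈y = begin-equality
        x + y - x    ≈⟨ +-congʳ (+-comm x y) ⟩
        y + x - x    ≈⟨ +-assoc y x (- x) ⟩
        y + (x - x)  ≈⟨ +-congˡ (-‿inverseʳ x) ⟩
        y + 0#       ≈⟨ +-identityʳ y ⟩
        y            ∎

    *-monoˡ-≤-nonneg : ∀ {c} → 0# ≤ c → ∀ {a b} → a ≤ b → (a * c) ≤ (b * c)
    *-monoˡ-≤-nonneg {c} 0≤c {a} {b} a≤b =
      0≤y-x⇒x≤y (≤-respʳ-≈ ([y-z]x≈yx-zx c b a) (*-nonneg (x≤y⇒0≤y-x a≤b) 0≤c))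

    0≤1 : 0# ≤ 1#
    0≤1 with total 0# 1#
    ... | inj₁ 0≤1 = 0≤1
    ... | inj₂ 1≤0 = begin
      0#          ≤⟨ *-nonneg 0≤-1 0≤-1 ⟩
      - 1# * - 1# ≈⟨ -‿distribˡ-* 1# (- 1#) ⟨
      - (1# * - 1#) ≈⟨ -‿cong (*-identityˡ (- 1#)) ⟩
      - - 1#      ≈⟨ -‿involutive 1# ⟩
      1#          ∎
      where
      0≤-1 : 0# ≤ (- 1#)
      0≤-1 = x≤0⇒0≤-x 1≤0

    1≉0 : ¬ (1# ≈ 0#)
    1≉0 = 0≉1 ∘ sym

    inverse-nonneg : ∀ {x y} → 0# ≤ x → x * y ≈ 1# → 0# ≤ y
    inverse-nonneg {x} {y} 0≤x xy≈1 with total 0# y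
    ... | inj₁ 0≤y = 0≤y
    ... | inj₂ y≤0 = ⊥-elim (0≉1 (antisym 0≤1 1≤0))
      where
      0≤-1 : 0# ≤ (- 1#)
      0≤-1 = begin
        0#        ≤⟨ *-nonneg 0≤x (x≤0⇒0≤-x y≤0) ⟩
        x * - y   ≈⟨ -‿distribʳ-* x y ⟨
        - (x * y) ≈⟨ -‿cong xy≈1 ⟩
        - 1#      ∎
      1≤0 : 1# ≤ 0#
      1≤0 = 0≤y-x⇒x≤y (≤-respʳ-≈ (sym (+-identityˡ (- 1#))) 0≤-1)

    ∑-nonneg : ∀ k (f : Fin k → Carrier) → (∀ i → 0# ≤ (f i)) → 0# ≤ (∑ K k f)
    ∑-nonneg zero    f 0≤f = ≤-refl
    ∑-nonneg (suc k) f 0≤f = ≤-trans (0≤f zero) (x≤x+y (f zero) (∑-nonneg k (f ∘ suc) (0≤f ∘ suc)))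

    ≤-∑ : ∀ k (f : Fin k → Carrier) → (∀ i → 0# ≤ (f i)) → ∀ i → f i ≤ ∑ K k f
    ≤-∑ k f 0≤f i = ≤-respʳ-≈ (sym (∑-split k i f)) (x≤x+y (f i) (∑-nonneg k _ 0≤rest))
      where
      0≤rest : ∀ j → 0# ≤ (if does (i ≟ j) then 0# else f j)
      0≤rest j with does (i ≟ j)
      ... | true  = ≤-refl
      ... | false = 0≤f j

    uniform-step-bound : ∀ k (d : Fin k → Carrier) → (∀ i → 0# ≤ (d i)) →
      Σ Carrier λ τ₀ → 0# < τ₀ × (∀ τ → τ ≤ τ₀ → ∀ i → (τ * d i) ≤ 1#)
    uniform-step-bound k d 0≤d = τ₀ , (0≤τ₀ , τ₀≉0) , τd≤1
      where
      M : Carrier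
      M = ∑ K k d + 1#
      1≤M : 1# ≤ M
      1≤M = ≤-respʳ-≈ (+-comm 1# _) (x≤x+y 1# (∑-nonneg k d 0≤d))
      M≉0 : ¬ (M ≈ 0#)
      M≉0 M≈0 = 0≉1 (antisym 0≤1 (≤-respʳ-≈ M≈0 1≤M))
      τ₀ : Carrier
      τ₀ = proj₁ (inverse M M≉0)
      Mτ₀≈1 : M * τ₀ ≈ 1#
      Mτ₀≈1 = proj₂ (inverse M M≉0)
      0≤τ₀ : 0# ≤ τ₀
      0≤τ₀ = inverse-nonneg (≤-trans 0≤1 1≤M) Mτ₀≈1
      τ₀≉0 : ¬ (0# ≈ τ₀)
      τ₀≉0 0≈τ₀ = 0≉1 (trans (sym (zeroʳ M)) (trans (*-congˡ 0≈τ₀) Mτ₀≈1))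
      τd≤1 : ∀ τ → τ ≤ τ₀ → ∀ i → (τ * d i) ≤ 1#
      τd≤1 τ τ≤τ₀ i = begin
        τ * d i   ≤⟨ *-monoˡ-≤-nonneg (0≤d i) τ≤τ₀ ⟩
        τ₀ * d i  ≈⟨ *-comm τ₀ (d i) ⟩
        d i * τ₀  ≤⟨ *-monoˡ-≤-nonneg 0≤τ₀ (≤-trans (≤-∑ k d 0≤d i) (x≤x+y _ 0≤1)) ⟩
        M * τ₀    ≈⟨ Mτ₀≈1 ⟩
        1#        ∎

  module _ {n : ℕ} {Q : Matrix K n} (rate : IsRateMatrix K n Q) where

    rate-diagonal-nonpos : ∀ x → 0# ≤ (- Q x x)
    rate-diagonal-nonpos x = ≤-respʳ-≈ offDiagonal≈-Qxx (∑-nonneg n _ 0≤offDiagonal)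
      where
      0≤offDiagonal : ∀ y → 0# ≤ (if does (x ≟ y) then 0# else Q x y)
      0≤offDiagonal y with x ≟ y
      ... | yes _   = ≤-refl
      ... | no x≢y = proj₁ rate x y x≢y
      offDiagonal≈-Qxx : ∑ K n (λ y → if does (x ≟ y) then 0# else Q x y) ≈ - Q x x
      offDiagonal≈-Qxx = +-inverseʳ-unique (Q x x) _ (trans (sym (∑-split n x (Q x))) (proj₂ rate x))

    I+τQ-stochastic : ∀ {τ} → 0# ≤ τ → (∀ x → (τ * - Q x x) ≤ 1#) →
      IsStochastic K n (I+τQ K n τ Q)
    I+τQ-stochastic {τ} 0≤τ τq≤1 = nonneg , rows
      where
      open SetoidReasoning setoid
      nonneg : ∀ x y → 0# ≤ (I+τQ K n τ Q x y)
      nonneg x y with x ≟ y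
      ... | no x≢y    = ≤-respʳ-≈ (sym (+-identityˡ _)) (*-nonneg 0≤τ (proj₁ rate x y x≢y))
      ... | yes ≡.refl = ≤-respʳ-≈ (+-congˡ -[τ*-q]≈τq) (x≤y⇒0≤y-x (τq≤1 x))
        where
        -[τ*-q]≈τq : - (τ * - Q x x) ≈ τ * Q x x
        -[τ*-q]≈τq = begin
          - (τ * - Q x x)  ≈⟨ -‿cong (-‿distribʳ-* τ (Q x x)) ⟨
          - - (τ * Q x x)  ≈⟨ -‿involutive _ ⟩
          τ * Q x x        ∎
      rows : ∀ x → ∑ K n (I+τQ K n τ Q x) ≈ 1#
      rows x = begin
        ∑ K n (I+τQ K n τ Q x)        ≈⟨ ∑-linear n τ (δ x) (Q x) ⟩
        ∑ K n (δ x) + τ * ∑ K n (Q x)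
          ≈⟨ +-cong (∑-select n x (λ _ → 1#)) (*-congˡ (proj₂ rate x)) ⟩
        1# + τ * 0#                   ≈⟨ +-congˡ (zeroʳ τ) ⟩
        1# + 0#                       ≈⟨ +-identityʳ 1# ⟩
        1#                            ∎

    I+τQ-stochastic-for-small-τ : Σ Carrier λ τ₀ → 0# < τ₀ ×
      (∀ τ → 0# < τ → τ ≤ τ₀ → IsStochastic K n (I+τQ K n τ Q))
    I+τQ-stochastic-for-small-τ with uniform-step-bound n (λ x → - Q x x) rate-diagonal-nonpos
    ... | τ₀ , 0<τ₀ , τq≤1 =
      τ₀ , 0<τ₀ , λ τ (0≤τ , _) τ≤τ₀ → I+τQ-stochastic 0≤τ (τq≤1 τ τ≤τ₀)

  module _ {n m : ℕ} (b : Fin n → Fin m) where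
    open SetoidReasoning setoid

    blockSum-cong : ∀ {s s′ : Vector K n} → (∀ x → s x ≈ s′ x) → ∀ C →
      blockSum K n m b s C ≈ blockSum K n m b s′ C
    blockSum-cong s≈s′ C = ∑-cong n (λ x → if-cong (does (b x ≟ C)) (s≈s′ x))

    blockSum-linear : ∀ τ (u v : Vector K n) C →
      blockSum K n m b (λ x → u x + τ * v x) C
        ≈ blockSum K n m b u C + τ * blockSum K n m b v C
    blockSum-linear τ u v C =
      trans (∑-cong n (λ x → if-distrib-linear (does (b x ≟ C)) τ (u x) (v x))) (∑-linear n τ _ _)

    blockSum-δ : ∀ x C → blockSum K n m b (δ x) C ≈ δ (b x) C
    blockSum-δ x C =
      trans (∑-single n x _ off) (if-cong (does (b x ≟ C)) (reflexive (δ-diagonal x)))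
      where
      off : ∀ y → y ≢ x → (if does (b y ≟ C) then δ x y else 0#) ≈ 0#
      off y y≢x = trans (if-cong (does (b y ≟ C)) (reflexive (δ-offDiagonal (y≢x ∘ ≡.sym))))
                        (if-then-0-else-0 (does (b y ≟ C)))

    blockSum-δ-cong : ∀ {x y} → b x ≡ b y → ∀ C →
      blockSum K n m b (δ x) C ≈ blockSum K n m b (δ y) C
    blockSum-δ-cong {x} {y} bx≡by C =
      trans (blockSum-δ x C) (trans (reflexive (≡.cong (λ i → δ i C) bx≡by)) (sym (blockSum-δ y C)))

    blockSum-transpose : ∀ (A : Matrix K n) (s : Vector K n) C →
      blockSum K n m b (λ x → ∑ K n (λ y → A y x * s y)) C
        ≈ ∑ K n (λ y → s y * blockSum K n m b (A y) C)
    blockSum-transpose A s C = begin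
      ∑ K n (λ x → if does (b x ≟ C) then ∑ K n (λ y → A y x * s y) else 0#)
        ≈⟨ ∑-cong n (λ x → if-distrib-∑ (does (b x ≟ C)) n _) ⟩
      ∑ K n (λ x → ∑ K n (λ y → if does (b x ≟ C) then A y x * s y else 0#))
        ≈⟨ ∑-comm n n _ ⟩
      ∑ K n (λ y → ∑ K n (λ x → if does (b x ≟ C) then A y x * s y else 0#))
        ≈⟨ ∑-cong n (λ y → ∑-cong n (λ x → if-distribʳ-* (does (b x ≟ C)) (A y x) (s y))) ⟩
      ∑ K n (λ y → ∑ K n (λ x → (if does (b x ≟ C) then A y x else 0#) * s y))
        ≈⟨ ∑-cong n (λ y → trans (sym (*-distribʳ-∑ n (s y) _)) (*-comm _ (s y))) ⟩
      ∑ K n (λ y → s y * blockSum K n m b (A y) C) ∎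

    ∑-blockwise : ∀ (s : Vector K n) (g : Fin m → Carrier) →
      ∑ K n (λ y → s y * g (b y)) ≈ ∑ K m (λ D → blockSum K n m b s D * g D)
    ∑-blockwise s g = begin
      ∑ K n (λ y → s y * g (b y))
        ≈⟨ ∑-cong n (λ y → ∑-select m (b y) (λ D → s y * g D)) ⟨
      ∑ K n (λ y → ∑ K m (λ D → if does (b y ≟ D) then s y * g D else 0#))
        ≈⟨ ∑-comm n m _ ⟩
      ∑ K m (λ D → ∑ K n (λ y → if does (b y ≟ D) then s y * g D else 0#))
        ≈⟨ ∑-cong m (λ D → ∑-cong n (λ y → if-distribʳ-* (does (b y ≟ D)) (s y) (g D))) ⟩
      ∑ K m (λ D → ∑ K n (λ y → (if does (b y ≟ D) then s y else 0#) * g D))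
        ≈⟨ ∑-cong m (λ D → *-distribʳ-∑ n (g D) _) ⟨
      ∑ K m (λ D → blockSum K n m b s D * g D) ∎

    blockConstant⇒factorsThrough : ∀ (g : Fin n → Carrier) → (∀ x y → b x ≡ b y → g x ≈ g y) →
      Σ (Fin m → Carrier) λ ĝ → ∀ x → g x ≈ ĝ (b x)
    blockConstant⇒factorsThrough g g-blockConstant = ĝ , g≈ĝ∘b
      where
      valueOn : ∀ {D} → Dec (∃ λ x → b x ≡ D) → Carrier
      valueOn (yes (x , _)) = g x
      valueOn (no _)        = 0#
      ĝ : Fin m → Carrier
      ĝ D = valueOn (any? λ x → b x ≟ D)
      g≈ĝ∘b : ∀ x → g x ≈ ĝ (b x)
      g≈ĝ∘b x with any? (λ y → b y ≟ b x)
      ... | yes (y , by≡bx) = g-blockConstant x y (≡.sym by≡bx)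
      ... | no ∄y           = ⊥-elim (∄y (x , ≡.refl))

    ∑-blockConstant-cong : ∀ (g : Fin n → Carrier) → (∀ x y → b x ≡ b y → g x ≈ g y) →
      ∀ {s s′ : Vector K n} → (∀ D → blockSum K n m b s D ≈ blockSum K n m b s′ D) →
      ∑ K n (λ y → s y * g y) ≈ ∑ K n (λ y → s′ y * g y)
    ∑-blockConstant-cong g g-blockConstant {s} {s′} s∼s′
      with ĝ , g≈ĝ∘b ← blockConstant⇒factorsThrough g g-blockConstant = begin
      ∑ K n (λ y → s y * g y)                   ≈⟨ ∑-cong n (λ y → *-congˡ (g≈ĝ∘b y)) ⟩
      ∑ K n (λ y → s y * ĝ (b y))               ≈⟨ ∑-blockwise s ĝ ⟩
      ∑ K m (λ D → blockSum K n m b s D * ĝ D)  ≈⟨ ∑-cong m (λ D → *-congʳ (s∼s′ D)) ⟩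
      ∑ K m (λ D → blockSum K n m b s′ D * ĝ D) ≈⟨ ∑-blockwise s′ ĝ ⟨
      ∑ K n (λ y → s′ y * ĝ (b y))              ≈⟨ ∑-cong n (λ y → *-congˡ (g≈ĝ∘b y)) ⟨
      ∑ K n (λ y → s′ y * g y)                  ∎

  module _ {n : ℕ} (Q : Matrix K n) (τ : Carrier) where
    open SetoidReasoning setoid

    F-δ : ∀ x y → F K n τ Q (δ x) y ≈ I+τQ K n τ Q x y
    F-δ x y = +-congˡ (*-congˡ Qᵀδ≈Q)
      where
      off : ∀ z → z ≢ x → Q z y * δ x z ≈ 0#
      off z z≢x = trans (*-congˡ (reflexive (δ-offDiagonal (z≢x ∘ ≡.sym)))) (zeroʳ _)
      Qᵀδ≈Q : ∑ K n (λ z → Q z y * δ x z) ≈ Q x y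
      Qᵀδ≈Q = trans (∑-single n x _ off) (trans (*-congˡ (reflexive (δ-diagonal x))) (*-identityʳ _))

    module _ {m : ℕ} (b : Fin n → Fin m) where

      blockSum-F : ∀ s C →
        blockSum K n m b (F K n τ Q s) C
          ≈ blockSum K n m b s C + τ * ∑ K n (λ y → s y * blockSum K n m b (Q y) C)
      blockSum-F s C =
        trans (blockSum-linear b τ s _ C) (+-congˡ (*-congˡ (blockSum-transpose b Q s C)))

      lumpability⇒GFB : IsOrdinaryLumpability K n m Q b → IsGFB K n m (F K n τ Q) b
      lumpability⇒GFB lumpable s s′ s∼s′ C = begin
        blockSum K n m b (F K n τ Q s) C
          ≈⟨ blockSum-F s C ⟩
        blockSum K n m b s C + τ * ∑ K n (λ y → s y * blockSum K n m b (Q y) C)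
          ≈⟨ +-cong (s∼s′ C) (*-congˡ (∑-blockConstant-cong b _ (lumpable C) s∼s′)) ⟩
        blockSum K n m b s′ C + τ * ∑ K n (λ y → s′ y * blockSum K n m b (Q y) C)
          ≈⟨ blockSum-F s′ C ⟨
        blockSum K n m b (F K n τ Q s′) C ∎

      GFB⇒probabilisticBisimulation : IsGFB K n m (F K n τ Q) b →
        IsProbabilisticBisimulation K n m (I+τQ K n τ Q) b
      GFB⇒probabilisticBisimulation gfb C x y bx≡by = begin
        blockSum K n m b (I+τQ K n τ Q x) C   ≈⟨ blockSum-cong b (F-δ x) C ⟨
        blockSum K n m b (F K n τ Q (δ x)) C ≈⟨ gfb (δ x) (δ y) (blockSum-δ-cong b bx≡by) C ⟩
        blockSum K n m b (F K n τ Q (δ y)) C ≈⟨ blockSum-cong b (F-δ y) C ⟩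
        blockSum K n m b (I+τQ K n τ Q y) C   ∎

      lumpability⇔probabilisticBisimulation : ¬ (τ ≈ 0#) →
        IsOrdinaryLumpability K n m Q b ⇔ IsProbabilisticBisimulation K n m (I+τQ K n τ Q) b
      lumpability⇔probabilisticBisimulation τ≉0 = mk⇔ to from
        where
        row : ∀ x C → blockSum K n m b (I+τQ K n τ Q x) C
                        ≈ blockSum K n m b (δ x) C + τ * blockSum K n m b (Q x) C
        row x C = blockSum-linear b τ (δ x) (Q x) C
        to : IsOrdinaryLumpability K n m Q b → IsProbabilisticBisimulation K n m (I+τQ K n τ Q) b
        to lumpable C x y bx≡by = begin
          blockSum K n m b (I+τQ K n τ Q x) C                     ≈⟨ row x C ⟩
          blockSum K n m b (δ x) C + τ * blockSum K n m b (Q x) C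
            ≈⟨ +-cong (blockSum-δ-cong b bx≡by C) (*-congˡ (lumpable C x y bx≡by)) ⟩
          blockSum K n m b (δ y) C + τ * blockSum K n m b (Q y) C ≈⟨ row y C ⟨
          blockSum K n m b (I+τQ K n τ Q y) C                     ∎
        from : IsProbabilisticBisimulation K n m (I+τQ K n τ Q) b → IsOrdinaryLumpability K n m Q b
        from bisimilar C x y bx≡by = *-cancelˡ-≉0 τ≉0 (+-cancelˡ _ _ _ (begin
          blockSum K n m b (δ x) C + τ * blockSum K n m b (Q x) C ≈⟨ row x C ⟨
          blockSum K n m b (I+τQ K n τ Q x) C                     ≈⟨ bisimilar C x y bx≡by ⟩
          blockSum K n m b (I+τQ K n τ Q y) C                     ≈⟨ row y C ⟩
          blockSum K n m b (δ y) C + τ * blockSum K n m b (Q y) C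
            ≈⟨ +-congʳ (blockSum-δ-cong b bx≡by C) ⟨
          blockSum K n m b (δ x) C + τ * blockSum K n m b (Q y) C ∎))

corollary3 : ∀ {c ℓ₁ ℓ₂} (K : OrderedField c ℓ₁ ℓ₂) (n : ℕ) (Q : Matrix K n) →
    IsRateMatrix K n Q →
    Σ (OrderedField.Carrier K) (λ τ₀ → OrderedField._<_ K (OrderedField.0# K) τ₀ ×
      (∀ τ → OrderedField._<_ K (OrderedField.0# K) τ → OrderedField._≤_ K τ τ₀ →
        IsStochastic K n (I+τQ K n τ Q)))
    ×
    (∀ (m : ℕ) (b : Fin n → Fin m) →
      ((∀ τ → OrderedField._<_ K (OrderedField.0# K) τ → IsGFB K n m (F K n τ Q) b)
        ⇔ IsOrdinaryLumpability K n m Q b)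
      ×
      (IsOrdinaryLumpability K n m Q b
        ⇔ (∀ τ → OrderedField._<_ K (OrderedField.0# K) τ →
             IsStochastic K n (I+τQ K n τ Q) →
             IsProbabilisticBisimulation K n m (I+τQ K n τ Q) b)))
corollary3 K n Q rate =
  let small-steps@(τ₀ , 0<τ₀@(_ , 0≉τ₀) , stochastic) = I+τQ-stochastic-for-small-τ rate in
  small-steps , λ m b →
    mk⇔ (λ gfb → Equivalence.from (lumpability⇔probabilisticBisimulation Q 1# b 1≉0)
                   (GFB⇒probabilisticBisimulation Q 1# b (gfb 1# (0≤1 , 0≉1))))
        (λ lumpable τ _ → lumpability⇒GFB Q τ b lumpable)
  , mk⇔ (λ lumpable τ (_ , 0≉τ) _ →
           Equivalence.to (lumpability⇔probabilisticBisimulation Q τ b (0≉τ ∘ sym)) lumpable)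
        (λ bisimilar →
           Equivalence.from (lumpability⇔probabilisticBisimulation Q τ₀ b (0≉τ₀ ∘ sym))
             (bisimilar τ₀ 0<τ₀ (stochastic τ₀ 0<τ₀ (IsTotalOrder.refl isTotalOrder))))
  where
  open OrderedField K using (1#; 0≉1; sym; isTotalOrder)
  open OrderedFieldProperties K
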